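{- The subgroup $U$ of $\Omega$ is abelian.
   Context: Let $T$ be the infinite regular rooted binary tree (vertices: finite words over $\{1,2\}$) and $\Omega=\mathrm{Aut}(T)$ with the profinite topology. Write elements of $\Omega$ as $(u,v)\tau$ with $u,v\in\Omega$ (actions on the two subtrees at level 1) and $\tau\in\{\mathrm{id},\sigma\}$, $\sigma=(\mathrm{id},\mathrm{id})\sigma$ the swap; multiplication: $(x_1,x_2)\tau(y_1,y_2)\tau'=(x_1y_{\tau(1)},x_2y_{\tau(2)})\tau\tau'$. Let $a_1,a_2,a_3\in\Omega$ be the unique elements with $a_1=\sigma$, $a_2=(a_3^{ -1},a_2^{ -1})\sigma$, $a_3=(a_2,a_3)$. Let $G$ be the closed subgroup topologically generated by $a_1,a_2,a_3$, and let $U$ be the closed normal subgroup of $G$ generated by $a_2a_3^{ -1}$ (the closure of the normal closure in $G$ of $\langle a_2a_3^{ -1}\rangle$). -}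

module Defs where

open import Data.Bool using (Bool; true; false; _xor_)
open import Data.List using (List; []; _∷_; length)
open import Data.Nat using (ℕ; _<_)
open import Data.Product using (Σ; _×_)
open import Data.Sum using (_⊎_)
open import Relation.Binary.PropositionalEquality using (_≡_)

-- Letters of the binary alphabet {1,2}: false = 1, true = 2.
-- Vertices of T: finite words (List Bool).

-- An element of Ω = Aut(T) is given by its portrait: the label at each
-- vertex w says whether the automorphism swaps the two children of w
-- (true = σ, false = id) -- this is the iterated wreath recursion.
Ω : Set
Ω = List Bool → Bool

sec : Ω → Bool → Ω
sec g x w = g (x ∷ w)

-- image w^g of a vertex (automorphisms act on the right, matching the
-- multiplication rule (x1,x2)τ(y1,y2)τ' = (x1 y_{τ(1)}, x2 y_{τ(2)}) ττ')
act : Ω → List Bool → List Bool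
act g [] = []
act g (x ∷ w) = (x xor g []) ∷ act (sec g x) w

actInv : Ω → List Bool → List Bool
actInv g [] = []
actInv g (x ∷ w) = (x xor g []) ∷ actInv (sec g (x xor g [])) w

e : Ω
e _ = false

infixl 7 _*_
_*_ : Ω → Ω → Ω
(g * h) w = g w xor h (act g w)

_⁻¹ : Ω → Ω
(g ⁻¹) w = g (actInv g w)

_≈_ : Ω → Ω → Set
g ≈ h = ∀ w → g w ≡ h w

-- agreement on the first n levels (profinite topology: basic neighbourhoods)
Agree : ℕ → Ω → Ω → Set
Agree n g h = ∀ w → length w < n → g w ≡ h w

data Gen (S : Ω → Set) : Ω → Set where
  gen : ∀ {g} → S g → Gen S g
  one : Gen S e
  mul : ∀ {g h} → Gen S g → Gen S h → Gen S (g * h)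
  inv : ∀ {g} → Gen S g → Gen S (g ⁻¹)

Cl : (Ω → Set) → Ω → Set
Cl S g = ∀ n → Σ Ω (λ h → S h × Agree n g h)

ClGen : (Ω → Set) → Ω → Set
ClGen S = Cl (Gen S)

-- The elements a1, a2, a3 (and a2⁻¹, a3⁻¹) as states of the finite automaton
-- realising the unique solution of
--   a1 = σ, a2 = (a3⁻¹, a2⁻¹)σ, a3 = (a2, a3),
-- which forces a2⁻¹ = (a2, a3)σ, a3⁻¹ = (a2⁻¹, a3⁻¹).
data St : Set where
  sId sσ s2 s2i s3 s3i : St

label : St → Bool
label sId = false
label sσ  = true
label s2  = true
label s2i = true
label s3  = false
label s3i = false

next : St → Bool → St
next sId _     = sId
next sσ  _     = sId
next s2  false = s3i
next s2  true  = s2i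
next s2i false = s2
next s2i true  = s3
next s3  false = s2
next s3  true  = s3
next s3i false = s2i
next s3i true  = s3i

portrait : St → Ω
portrait q []      = label q
portrait q (x ∷ w) = portrait (next q x) w

a₁ a₂ a₃ : Ω
a₁ = portrait sσ
a₂ = portrait s2
a₃ = portrait s3

Gens : Ω → Set
Gens g = (g ≡ a₁) ⊎ ((g ≡ a₂) ⊎ (g ≡ a₃))

G : Ω → Set
G = ClGen Gens

ConjG : Ω → Set
ConjG y = Σ Ω (λ g → G g × (y ≡ (g * (a₂ * (a₃ ⁻¹))) * (g ⁻¹)))

U : Ω → Set
U = ClGen ConjG

-- Let c = a₂a₃⁻¹. The automorphisms a₁, a₂, a₃ and their inverses are states of a six-state
-- automaton, so every product of them is again finite-state and equality of two such products is
-- decided by exhibiting a finite bisimulation between them. In this way one checks that the four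
-- elements c, c^{a₁}, c^{a₂}, c^{a₂⁻¹} commute pairwise and that conjugation by a₁ and by a₂^{±1}
-- permutes them. As a₃ = c⁻¹a₂, the abelian subgroup N they generate is normalised by
-- ⟨a₁, a₂, a₃⟩, so by continuity of conjugation every G-conjugate of c lies in the closure of N,
-- and so does U. Finally the closure of an abelian subgroup is abelian, because the first n levels
-- of a product only depend on the first n levels of its factors.
module Submission where

open import Algebra.Bundles using (Group)

module GroupProperties {c ℓ} (𝔾 : Group c ℓ) where

  open Group 𝔾
  open import Algebra.Properties.Group 𝔾
    using ( \\-leftDividesʳ; //-rightDividesˡ; //-rightDividesʳ; inverseˡ-unique; ε⁻¹≈ε
          ; ⁻¹-anti-homo-∙; ⁻¹-anti-homo-// )
  open import Relation.Binary.Reasoning.Setoid setoid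

  conj : Carrier → Carrier → Carrier
  conj h x = h ∙ x ∙ h ⁻¹

  conj-congˡ : ∀ {g h} → g ≈ h → ∀ x → conj g x ≈ conj h x
  conj-congˡ g≈h x = ∙-cong (∙-congʳ g≈h) (⁻¹-cong g≈h)

  conj-congʳ : ∀ h {x y} → x ≈ y → conj h x ≈ conj h y
  conj-congʳ h x≈y = ∙-congʳ (∙-congˡ x≈y)

  conj-homo-∙ : ∀ h x y → conj h (x ∙ y) ≈ conj h x ∙ conj h y
  conj-homo-∙ h x y = begin
    h ∙ (x ∙ y) ∙ h ⁻¹               ≈⟨ ∙-congʳ (assoc h x y) ⟨
    h ∙ x ∙ y ∙ h ⁻¹                 ≈⟨ ∙-congʳ (∙-congʳ (//-rightDividesˡ h (h ∙ x))) ⟨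
    h ∙ x ∙ h ⁻¹ ∙ h ∙ y ∙ h ⁻¹       ≈⟨ ∙-congʳ (assoc (conj h x) h y) ⟩
    conj h x ∙ (h ∙ y) ∙ h ⁻¹         ≈⟨ assoc (conj h x) (h ∙ y) (h ⁻¹) ⟩
    conj h x ∙ conj h y               ∎

  conj-ε : ∀ h → conj h ε ≈ ε
  conj-ε h = trans (∙-congʳ (identityʳ h)) (inverseʳ h)

  conj-homo-⁻¹ : ∀ h x → conj h (x ⁻¹) ≈ conj h x ⁻¹
  conj-homo-⁻¹ h x = inverseˡ-unique (conj h (x ⁻¹)) (conj h x) (begin
    conj h (x ⁻¹) ∙ conj h x  ≈⟨ conj-homo-∙ h (x ⁻¹) x ⟨
    conj h (x ⁻¹ ∙ x)        ≈⟨ conj-congʳ h (inverseˡ x) ⟩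
    conj h ε                 ≈⟨ conj-ε h ⟩
    ε                        ∎)

  conj-by-ε : ∀ x → conj ε x ≈ x
  conj-by-ε x = trans (∙-cong (identityˡ x) ε⁻¹≈ε) (identityʳ x)

  conj-by-∙ : ∀ g h x → conj (g ∙ h) x ≈ conj g (conj h x)
  conj-by-∙ g h x = begin
    g ∙ h ∙ x ∙ (g ∙ h) ⁻¹       ≈⟨ ∙-congˡ (⁻¹-anti-homo-∙ g h) ⟩
    g ∙ h ∙ x ∙ (h ⁻¹ ∙ g ⁻¹)    ≈⟨ assoc (g ∙ h ∙ x) (h ⁻¹) (g ⁻¹) ⟨
    g ∙ h ∙ x ∙ h ⁻¹ ∙ g ⁻¹      ≈⟨ ∙-congʳ (∙-congʳ (assoc g h x)) ⟩
    g ∙ (h ∙ x) ∙ h ⁻¹ ∙ g ⁻¹    ≈⟨ ∙-congʳ (assoc g (h ∙ x) (h ⁻¹)) ⟩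
    g ∙ conj h x ∙ g ⁻¹          ∎

  [x∙y⁻¹]⁻¹∙x≈y : ∀ x y → (x ∙ y ⁻¹) ⁻¹ ∙ x ≈ y
  [x∙y⁻¹]⁻¹∙x≈y x y = trans (∙-congʳ (⁻¹-anti-homo-// x y)) (//-rightDividesˡ x y)

  Commute : Carrier → Carrier → Set ℓ
  Commute x y = x ∙ y ≈ y ∙ x

  commute-ε : ∀ x → Commute x ε
  commute-ε x = trans (identityʳ x) (sym (identityˡ x))

  commute-∙ : ∀ {x y z} → Commute x y → Commute x z → Commute x (y ∙ z)
  commute-∙ {x} {y} {z} xy≈yx xz≈zx = begin
    x ∙ (y ∙ z)  ≈⟨ assoc x y z ⟨
    x ∙ y ∙ z    ≈⟨ ∙-congʳ xy≈yx ⟩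
    y ∙ x ∙ z    ≈⟨ assoc y x z ⟩
    y ∙ (x ∙ z)  ≈⟨ ∙-congˡ xz≈zx ⟩
    y ∙ (z ∙ x)  ≈⟨ assoc y z x ⟨
    y ∙ z ∙ x    ∎

  commute-⁻¹ : ∀ {x y} → Commute x y → Commute x (y ⁻¹)
  commute-⁻¹ {x} {y} xy≈yx = begin
    x ∙ y ⁻¹                ≈⟨ \\-leftDividesʳ y (x ∙ y ⁻¹) ⟨
    y ⁻¹ ∙ (y ∙ (x ∙ y ⁻¹))  ≈⟨ ∙-congˡ (assoc y x (y ⁻¹)) ⟨
    y ⁻¹ ∙ (y ∙ x ∙ y ⁻¹)    ≈⟨ ∙-congˡ (∙-congʳ xy≈yx) ⟨
    y ⁻¹ ∙ (x ∙ y ∙ y ⁻¹)    ≈⟨ ∙-congˡ (//-rightDividesʳ y x) ⟩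
    y ⁻¹ ∙ x                ∎

open import Defs
open import Data.Bool using (Bool; true; false; T; _∧_; _xor_; if_then_else_)
import Data.Bool.Properties as Bool
open import Data.Fin using (Fin; toℕ) renaming (_<_ to _<ᶠ_)
open import Data.Fin.Patterns using (0F; 1F; 2F; 3F; 4F; 5F)
import Data.Fin.Properties as Fin
open import Data.Bool.ListAction using (all; any)
open import Data.List using (List; []; _∷_; [_]; _++_; length)
open import Data.List.Membership.Propositional using (_∈_)
import Data.List.Relation.Unary.All as All
open import Data.List.Relation.Unary.All.Properties using (all⁺)
import Data.List.Relation.Unary.Any as Any
open import Data.List.Relation.Unary.Any.Properties using (any⁻)
open import Data.Nat using (ℕ; zero; suc; _≤_; _<_; _≡ᵇ_; s≤s; z≤n)
open import Data.Nat.Properties using (≡ᵇ⇒≡; <⇒≤; ≤-refl)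
open import Data.Product using (∃-syntax; _×_; _,_; proj₁; proj₂)
open import Data.Sum using (inj₁; inj₂)
open import Function using (_∘_; Equivalence)
open import Level using (0ℓ)
open import Relation.Binary.Structures using (IsEquivalence)
open import Relation.Binary.Definitions using (_Respects_; tri<; tri≈; tri>)
open import Relation.Binary.PropositionalEquality
  using (_≡_; refl; sym; trans; cong; cong₂; subst; module ≡-Reasoning)
open import Relation.Nullary.Decidable using (Dec; isYes; toWitness; T?; from-yes; _→-dec_)
open import Relation.Unary using (Pred; _⊆_)
import Relation.Binary.Reasoning.Setoid

-- Pointwise equality wrapped in a record: unlike g ≈ h, which unfolds to a Π-type, g ≋ h
-- determines g and h, so that implicit arguments of the generic group lemmas can be inferred.
infix 4 _≋_
record _≋_ (g h : Ω) : Set where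
  constructor pointwise
  field at : g ≈ h
open _≋_

-- Continuity of multiplication and inversion

length-act : ∀ g w → length (act g w) ≡ length w
length-act g []      = refl
length-act g (x ∷ w) = cong suc (length-act (sec g x) w)

length-actInv : ∀ g w → length (actInv g w) ≡ length w
length-actInv g []      = refl
length-actInv g (x ∷ w) = cong suc (length-actInv (sec g (x xor g [])) w)

agree-act : ∀ {n g h} → Agree n g h → ∀ w → length w ≤ n → act g w ≡ act h w
agree-act         g~h []      _           = refl
agree-act {suc n} g~h (x ∷ w) (s≤s |w|≤n) =
  cong₂ _∷_ (cong (x xor_) (g~h [] (s≤s z≤n)))
            (agree-act (λ v |v|<n → g~h (x ∷ v) (s≤s |v|<n)) w |w|≤n)

agree-actInv : ∀ {n g h} → Agree n g h → ∀ w → length w ≤ n → actInv g w ≡ actInv h w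
agree-actInv         g~h []      _           = refl
agree-actInv {suc n} g~h (x ∷ w) (s≤s |w|≤n) rewrite g~h [] (s≤s z≤n) =
  cong (_ ∷_) (agree-actInv (λ v |v|<n → g~h (_ ∷ v) (s≤s |v|<n)) w |w|≤n)

agree-* : ∀ {n g g′ h h′} → Agree n g g′ → Agree n h h′ → Agree n (g * h) (g′ * h′)
agree-* {g = g} {g′} {h} {h′} g~g′ h~h′ w |w|<n = cong₂ _xor_ (g~g′ w |w|<n) (begin
  h (act g w)   ≡⟨ cong h (agree-act g~g′ w (<⇒≤ |w|<n)) ⟩
  h (act g′ w)  ≡⟨ h~h′ (act g′ w) (subst (_< _) (sym (length-act g′ w)) |w|<n) ⟩
  h′ (act g′ w) ∎)
  where open ≡-Reasoning

agree-⁻¹ : ∀ {n g h} → Agree n g h → Agree n (g ⁻¹) (h ⁻¹)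
agree-⁻¹ {g = g} {h} g~h w |w|<n =
  trans (cong g (agree-actInv g~h w (<⇒≤ |w|<n)))
        (g~h (actInv h w) (subst (_< _) (sym (length-actInv h w)) |w|<n))

agree-refl : ∀ {n} g → Agree n g g
agree-refl g w _ = refl

agree-trans : ∀ {n g h k} → Agree n g h → Agree n h k → Agree n g k
agree-trans g~h h~k w |w|<n = trans (g~h w |w|<n) (h~k w |w|<n)

≋⇒agree : ∀ {n g h} → g ≋ h → Agree n g h
≋⇒agree g≋h w _ = g≋h .at w

act-* : ∀ g h w → act (g * h) w ≡ act h (act g w)
act-* g h []      = refl
act-* g h (x ∷ w) = cong₂ _∷_ (sym (Bool.xor-assoc x (g []) (h []))) (act-* (sec g x) (sec h (x xor g [])) w)

act-e : ∀ w → act e w ≡ w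
act-e []      = refl
act-e (x ∷ w) = cong₂ _∷_ (Bool.xor-identityʳ x) (act-e w)

xor-cancelʳ : ∀ x y → (x xor y) xor y ≡ x
xor-cancelʳ x y = trans (Bool.xor-assoc x y y) (trans (cong (x xor_) (Bool.xor-same y)) (Bool.xor-identityʳ x))

actInv-act : ∀ g w → actInv g (act g w) ≡ w
actInv-act g []      = refl
actInv-act g (x ∷ w) rewrite xor-cancelʳ x (g []) = cong (x ∷_) (actInv-act (sec g x) w)

act-⁻¹ : ∀ g w → act (g ⁻¹) w ≡ actInv g w
act-⁻¹ g []      = refl
act-⁻¹ g (x ∷ w) = cong (_ ∷_) (act-⁻¹ (sec g (x xor g [])) w)

≋-isEquivalence : IsEquivalence _≋_
≋-isEquivalence = record
  { refl  = pointwise λ _ → refl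
  ; sym   = λ g≋h → pointwise λ w → sym (g≋h .at w)
  ; trans = λ g≋h h≋k → pointwise λ w → trans (g≋h .at w) (h≋k .at w)
  }

*-cong : ∀ {g g′ h h′} → g ≋ g′ → h ≋ h′ → g * h ≋ g′ * h′
*-cong g≋g′ h≋h′ .at w = agree-* (≋⇒agree g≋g′) (≋⇒agree h≋h′) w ≤-refl

⁻¹-cong : ∀ {g h} → g ≋ h → g ⁻¹ ≋ h ⁻¹
⁻¹-cong g≋h .at w = agree-⁻¹ (≋⇒agree g≋h) w ≤-refl

*-assoc : ∀ g h k → (g * h) * k ≋ g * (h * k)
*-assoc g h k .at w =
  trans (Bool.xor-assoc (g w) _ _) (cong (λ v → g w xor (h (act g w) xor k v)) (act-* g h w))

*-identityˡ : ∀ g → e * g ≋ g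
*-identityˡ g .at w = cong g (act-e w)

*-identityʳ : ∀ g → g * e ≋ g
*-identityʳ g .at w = Bool.xor-identityʳ (g w)

*-inverseˡ : ∀ g → g ⁻¹ * g ≋ e
*-inverseˡ g .at w =
  trans (cong (λ v → g (actInv g w) xor g v) (act-⁻¹ g w)) (Bool.xor-same (g (actInv g w)))

*-inverseʳ : ∀ g → g * g ⁻¹ ≋ e
*-inverseʳ g .at w = trans (cong (λ v → g w xor g v) (actInv-act g w)) (Bool.xor-same (g w))

Ω-group : Group 0ℓ 0ℓ
Ω-group = record
  { _≈_     = _≋_
  ; isGroup = record
    { isMonoid = record
      { isSemigroup = record
        { isMagma  = record { isEquivalence = ≋-isEquivalence ; ∙-cong = *-cong }
        ; assoc    = *-assoc
        }
      ; identity = *-identityˡ , *-identityʳ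
      }
    ; inverse = *-inverseˡ , *-inverseʳ
    ; ⁻¹-cong = ⁻¹-cong
    }
  }

open Group Ω-group using (setoid) renaming (refl to ≋-refl; sym to ≋-sym; trans to ≋-trans)
open import Algebra.Properties.Group Ω-group
  using (⁻¹-involutive; ⁻¹-anti-homo-∙; ε⁻¹≈ε; inverseʳ-unique)
open GroupProperties Ω-group
module ≋-Reasoning = Relation.Binary.Reasoning.Setoid setoid

-- Generated subgroups, normalisers and closures

Gen≋ : Pred Ω 0ℓ → Pred Ω 0ℓ
Gen≋ S x = ∃[ y ] Gen S y × x ≋ y

Gen≋-resp : ∀ {S} → Gen≋ S Respects _≋_
Gen≋-resp x≋x′ (y , Sy , x≋y) = y , Sy , ≋-trans (≋-sym x≋x′) x≋y

Gen≋-e : ∀ {S} → Gen≋ S e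
Gen≋-e = e , one , ≋-refl

Gen≋-* : ∀ {S x y} → Gen≋ S x → Gen≋ S y → Gen≋ S (x * y)
Gen≋-* (x′ , Sx′ , x≋x′) (y′ , Sy′ , y≋y′) = x′ * y′ , mul Sx′ Sy′ , *-cong x≋x′ y≋y′

Gen≋-⁻¹ : ∀ {S x} → Gen≋ S x → Gen≋ S (x ⁻¹)
Gen≋-⁻¹ (x′ , Sx′ , x≋x′) = x′ ⁻¹ , inv Sx′ , ⁻¹-cong x≋x′

Gen-centralises : ∀ {S} x → S ⊆ Commute x → Gen S ⊆ Commute x
Gen-centralises x S⊆ (gen s)           = S⊆ s
Gen-centralises x S⊆ one               = commute-ε x
Gen-centralises x S⊆ (mul {g} {h} p q) =
  commute-∙ {x} {g} {h} (Gen-centralises x S⊆ p) (Gen-centralises x S⊆ q)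
Gen-centralises x S⊆ (inv {g} p)       = commute-⁻¹ {x} {g} (Gen-centralises x S⊆ p)

Gen-abelian : ∀ {S} → (∀ {s t} → S s → S t → Commute s t)
            → ∀ {x y} → Gen S x → Gen S y → Commute x y
Gen-abelian S-comm {x} Sx =
  Gen-centralises x (λ {t} St → ≋-sym (Gen-centralises t (S-comm St) Sx))

-- A record for the same reason as _≋_.
record Normalises (h : Ω) (P : Pred Ω 0ℓ) : Set where
  field preserves : P ⊆ P ∘ conj h
open Normalises

Normaliser : Pred Ω 0ℓ → Pred Ω 0ℓ
Normaliser P h = Normalises h P × Normalises (h ⁻¹) P

module _ {P : Pred Ω 0ℓ} (P-resp : P Respects _≋_) where

  normalises-resp : ∀ {g h} → g ≋ h → Normalises g P → Normalises h P
  normalises-resp g≋h g-norm .preserves {x} Px = P-resp (conj-congˡ g≋h x) (g-norm .preserves Px)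

  normalises-e : Normalises e P
  normalises-e .preserves {x} Px = P-resp (≋-sym (conj-by-ε x)) Px

  normalises-* : ∀ {g h} → Normalises g P → Normalises h P → Normalises (g * h) P
  normalises-* {g} {h} g-norm h-norm .preserves {x} Px =
    P-resp (≋-sym (conj-by-∙ g h x)) (g-norm .preserves (h-norm .preserves Px))

  normaliser-resp : ∀ {g h} → g ≋ h → Normaliser P g → Normaliser P h
  normaliser-resp g≋h (g-norm , g⁻¹-norm) =
    normalises-resp g≋h g-norm , normalises-resp (⁻¹-cong g≋h) g⁻¹-norm

  normaliser-* : ∀ {g h} → Normaliser P g → Normaliser P h → Normaliser P (g * h)
  normaliser-* {g} {h} (g-norm , g⁻¹-norm) (h-norm , h⁻¹-norm) =
      normalises-* g-norm h-norm
    , normalises-resp (≋-sym (⁻¹-anti-homo-∙ g h)) (normalises-* h⁻¹-norm g⁻¹-norm)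

  normaliser-⁻¹ : ∀ {h} → Normaliser P h → Normaliser P (h ⁻¹)
  normaliser-⁻¹ {h} (h-norm , h⁻¹-norm) = h⁻¹-norm , normalises-resp (≋-sym (⁻¹-involutive h)) h-norm

  Gen⊆Normaliser : ∀ {T} → T ⊆ Normaliser P → Gen T ⊆ Normaliser P
  Gen⊆Normaliser T⊆ (gen t)   = T⊆ t
  Gen⊆Normaliser T⊆ one       = normalises-e , normalises-resp (≋-sym ε⁻¹≈ε) normalises-e
  Gen⊆Normaliser T⊆ (mul p q) = normaliser-* (Gen⊆Normaliser T⊆ p) (Gen⊆Normaliser T⊆ q)
  Gen⊆Normaliser T⊆ (inv p)   = normaliser-⁻¹ (Gen⊆Normaliser T⊆ p)

Gen≋-normalises : ∀ {S h} → (S ⊆ Gen≋ S ∘ conj h) → Normalises h (Gen≋ S)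
Gen≋-normalises {S} {h} S⊆ .preserves (y , Sy , x≋y) =
  Gen≋-resp (conj-congʳ h (≋-sym x≋y)) (conj-Gen Sy)
  where
  conj-Gen : Gen S ⊆ Gen≋ S ∘ conj h
  conj-Gen (gen s)           = S⊆ s
  conj-Gen one               = Gen≋-resp (≋-sym (conj-ε h)) Gen≋-e
  conj-Gen (mul {x} {y} p q) = Gen≋-resp (≋-sym (conj-homo-∙ h x y)) (Gen≋-* (conj-Gen p) (conj-Gen q))
  conj-Gen (inv {x} p)       = Gen≋-resp (≋-sym (conj-homo-⁻¹ h x)) (Gen≋-⁻¹ (conj-Gen p))

Gen≋⊆Normaliser : ∀ {S} → Gen≋ S ⊆ Normaliser (Gen≋ S)
Gen≋⊆Normaliser Sh .proj₁ .preserves Sx = Gen≋-* (Gen≋-* Sh Sx) (Gen≋-⁻¹ Sh)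
Gen≋⊆Normaliser Sh .proj₂ .preserves Sx = Gen≋-* (Gen≋-* (Gen≋-⁻¹ Sh) Sx) (Gen≋-⁻¹ (Gen≋-⁻¹ Sh))

Cl-mono : ∀ {P Q} → P ⊆ Q → Cl P ⊆ Cl Q
Cl-mono P⊆Q ClPx n = let y , Py , x~y = ClPx n in y , P⊆Q Py , x~y

Cl-idempotent : ∀ {P} → Cl (Cl P) ⊆ Cl P
Cl-idempotent ClClPx n =
  let y , ClPy , x~y = ClClPx n
      z , Pz , y~z = ClPy n
  in z , Pz , agree-trans x~y y~z

Gen≋⊆ClGen : ∀ {S} → Gen≋ S ⊆ ClGen S
Gen≋⊆ClGen (y , Sy , x≋y) n = y , Sy , ≋⇒agree x≋y

Gen⊆ClGen : ∀ {S T} → T ⊆ ClGen S → Gen T ⊆ ClGen S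
Gen⊆ClGen T⊆ (gen t)     = T⊆ t
Gen⊆ClGen T⊆ one       n = e , one , agree-refl e
Gen⊆ClGen T⊆ (mul p q) n =
  let x , Sx , ~x = Gen⊆ClGen T⊆ p n
      y , Sy , ~y = Gen⊆ClGen T⊆ q n
  in x * y , mul Sx Sy , agree-* ~x ~y
Gen⊆ClGen T⊆ (inv p)   n = let x , Sx , ~x = Gen⊆ClGen T⊆ p n in x ⁻¹ , inv Sx , agree-⁻¹ ~x

ClGen-least : ∀ {S T} → T ⊆ ClGen S → ClGen T ⊆ ClGen S
ClGen-least T⊆ = Cl-idempotent ∘ Cl-mono (Gen⊆ClGen T⊆)

Cl-conj : ∀ {P T g} x → (T ⊆ Cl P ∘ λ h → conj h x) → Cl T g → Cl P (conj g x)
Cl-conj x T⊆ ClTg n =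
  let h , Th , g~h = ClTg n
      y , Py , hx~y = T⊆ Th n
  in y , Py , agree-trans (agree-* (agree-* g~h (agree-refl x)) (agree-⁻¹ g~h)) hx~y

Cl-abelian : ∀ {P} → (∀ {x y} → P x → P y → Commute x y)
           → ∀ {x y} → Cl P x → Cl P y → Commute x y
Cl-abelian P-comm {x} {y} ClPx ClPy .at w =
  let x′ , Px′ , x~x′ = ClPx (suc (length w))
      y′ , Py′ , y~y′ = ClPy (suc (length w))
  in begin
    (x * y) w    ≡⟨ agree-* x~x′ y~y′ w ≤-refl ⟩
    (x′ * y′) w  ≡⟨ P-comm Px′ Py′ .at w ⟩
    (y′ * x′) w  ≡⟨ agree-* y~y′ x~x′ w ≤-refl ⟨
    (y * x) w    ∎
  where open ≡-Reasoning

-- Automata and bisimulations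

module Automaton {Q : Set} (out : Q → Bool) (step : Q → Bool → Q) where

  run : Q → Ω
  run q []      = out q
  run q (x ∷ w) = run (step q x) w

  successor : Q × Q → Bool → Q × Q
  successor (p , q) x = step p x , step q x

  IsBisimulation : List (Q × Q) → Set
  IsBisimulation R = ∀ {p q} → (p , q) ∈ R → out p ≡ out q × (∀ x → successor (p , q) x ∈ R)

  bisimulation⇒≋ : ∀ {R p q} → IsBisimulation R → (p , q) ∈ R → run p ≋ run q
  bisimulation⇒≋ R-bisim pq∈R .at []      = proj₁ (R-bisim pq∈R)
  bisimulation⇒≋ R-bisim pq∈R .at (x ∷ w) = bisimulation⇒≋ R-bisim (proj₂ (R-bisim pq∈R) x) .at w

  -- Boolean rather than Dec-valued tests: the search is run by the type checker, where Dec is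
  -- much slower.
  module Search (_==_ : Q → Q → Bool) (==⇒≡ : ∀ p q → T (p == q) → p ≡ q) where

    _∈ᵇ_ : Q × Q → List (Q × Q) → Bool
    (p , q) ∈ᵇ R = any (λ (p′ , q′) → p == p′ ∧ q == q′) R

    ∈ᵇ⇒∈ : ∀ {pq} R → T (pq ∈ᵇ R) → pq ∈ R
    ∈ᵇ⇒∈ {p , q} R pq∈R = Any.map pair-≡ (any⁻ _ R pq∈R)
      where
      pair-≡ : ∀ {pq′} → T (p == proj₁ pq′ ∧ q == proj₂ pq′) → (p , q) ≡ pq′
      pair-≡ {p′ , q′} p=p′∧q=q′ =
        let p=p′ , q=q′ = Equivalence.to (Bool.T-∧ {p == p′}) p=p′∧q=q′
        in cong₂ _,_ (==⇒≡ p p′ p=p′) (==⇒≡ q q′ q=q′)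

    consistent : List (Q × Q) → Q × Q → Bool
    consistent R pq@(p , q) =
      isYes (out p Bool.≟ out q) ∧ (successor pq false ∈ᵇ R ∧ successor pq true ∈ᵇ R)

    isBisimulation : List (Q × Q) → Bool
    isBisimulation R = all (consistent R) R

    isBisimulation-sound : ∀ R → T (isBisimulation R) → IsBisimulation R
    isBisimulation-sound R R-bisim {p} {q} pq∈R =
      let pq-consistent    = All.lookup (all⁺ _ R R-bisim) pq∈R
          out≡ , succ∈R    = Equivalence.to (Bool.T-∧ {isYes (out p Bool.≟ out q)}) pq-consistent
          false∈R , true∈R = Equivalence.to (Bool.T-∧ {successor (p , q) false ∈ᵇ R}) succ∈R
      in toWitness {a? = out p Bool.≟ out q} out≡
       , λ { false → ∈ᵇ⇒∈ R false∈R ; true → ∈ᵇ⇒∈ R true∈R }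

    explore : ℕ → List (Q × Q) → List (Q × Q) → List (Q × Q)
    explore zero    todo        seen = seen
    explore (suc n) []          seen = seen
    explore (suc n) (pq ∷ todo) seen =
      if pq ∈ᵇ seen then explore n todo seen
      else explore n (successor pq false ∷ successor pq true ∷ todo) (pq ∷ seen)

    certifies : List (Q × Q) → Q × Q → Bool
    certifies R pq = isBisimulation R ∧ pq ∈ᵇ R

    -- The fuel only bounds the search: whatever it returns is checked by certifies.
    candidate : Q → Q → List (Q × Q)
    candidate p q = explore 1000 [ (p , q) ] []

    bisimilar : Q → Q → Bool
    bisimilar p q = certifies (candidate p q) (p , q)

    certifies-sound : ∀ R {p q} → T (certifies R (p , q)) → run p ≋ run q
    certifies-sound R R-certifies =
      let R-bisim , pq∈R = Equivalence.to (Bool.T-∧ {isBisimulation R}) R-certifies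
      in bisimulation⇒≋ (isBisimulation-sound R R-bisim) (∈ᵇ⇒∈ R pq∈R)

    bisimilar⇒≋ : ∀ p q → T (bisimilar p q) → run p ≋ run q
    bisimilar⇒≋ p q = certifies-sound (candidate p q)

index : St → Fin 6
index sId = 0F
index sσ  = 1F
index s2  = 2F
index s2i = 3F
index s3  = 4F
index s3i = 5F

state : Fin 6 → St
state 0F = sId
state 1F = sσ
state 2F = s2
state 3F = s2i
state 4F = s3
state 5F = s3i

state-index : ∀ q → state (index q) ≡ q
state-index sId = refl
state-index sσ  = refl
state-index s2  = refl
state-index s2i = refl
state-index s3  = refl
state-index s3i = refl

index-injective : ∀ {p q} → index p ≡ index q → p ≡ q
index-injective {p} {q} eq = trans (sym (state-index p)) (trans (cong state eq) (state-index q))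

_==_ : List St → List St → Bool
[]       == []       = true
(p ∷ ps) == (q ∷ qs) = (toℕ (index p) ≡ᵇ toℕ (index q)) ∧ ps == qs
_        == _        = false

==⇒≡ : ∀ ps qs → T (ps == qs) → ps ≡ qs
==⇒≡ []       []       _  = refl
==⇒≡ (p ∷ ps) (q ∷ qs) eq =
  let p=q , ps=qs = Equivalence.to (Bool.T-∧ {toℕ (index p) ≡ᵇ toℕ (index q)}) eq
  in cong₂ _∷_ (index-injective (Fin.toℕ-injective (≡ᵇ⇒≡ _ _ p=q))) (==⇒≡ ps qs ps=qs)

-- label⋆ and next⋆ are the wreath recursion of the product portrait q₁ * ... * qₖ.
label⋆ : List St → Bool
label⋆ []       = false
label⋆ (q ∷ qs) = label q xor label⋆ qs

next⋆ : List St → Bool → List St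
next⋆ []       x = []
next⋆ (q ∷ qs) x = next q x ∷ next⋆ qs (x xor label q)

open Automaton label⋆ next⋆ renaming (run to portrait⋆)
open Search _==_ ==⇒≡

label⋆-++ : ∀ ps qs → label⋆ (ps ++ qs) ≡ label⋆ ps xor label⋆ qs
label⋆-++ []       qs = sym (Bool.xor-identityˡ (label⋆ qs))
label⋆-++ (p ∷ ps) qs = trans (cong (label p xor_) (label⋆-++ ps qs)) (sym (Bool.xor-assoc (label p) _ _))

next⋆-++ : ∀ ps qs x → next⋆ (ps ++ qs) x ≡ next⋆ ps x ++ next⋆ qs (x xor label⋆ ps)
next⋆-++ []       qs x = cong (next⋆ qs) (sym (Bool.xor-identityʳ x))
next⋆-++ (p ∷ ps) qs x =
  cong (next p x ∷_) (trans (next⋆-++ ps qs (x xor label p))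
                            (cong (λ y → next⋆ ps (x xor label p) ++ next⋆ qs y)
                                  (Bool.xor-assoc x (label p) (label⋆ ps))))

portrait⋆-++ : ∀ ps qs → portrait⋆ (ps ++ qs) ≋ portrait⋆ ps * portrait⋆ qs
portrait⋆-++ ps qs .at []      = label⋆-++ ps qs
portrait⋆-++ ps qs .at (x ∷ w) rewrite next⋆-++ ps qs x =
  portrait⋆-++ (next⋆ ps x) (next⋆ qs (x xor label⋆ ps)) .at w

portrait⋆-[] : portrait⋆ [] ≋ e
portrait⋆-[] .at []      = refl
portrait⋆-[] .at (x ∷ w) = portrait⋆-[] .at w

portrait⋆-[_] : ∀ q → portrait⋆ [ q ] ≋ portrait q
portrait⋆-[ q ] .at []      = Bool.xor-identityʳ (label q)
portrait⋆-[ q ] .at (x ∷ w) = portrait⋆-[ next q x ] .at w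

invState : St → St
invState sId = sId
invState sσ  = sσ
invState s2  = s2i
invState s2i = s2
invState s3  = s3i
invState s3i = s3

invState-inverse : ∀ q → T (bisimilar (q ∷ invState q ∷ []) [])
invState-inverse q = subst (λ q → T (bisimilar (q ∷ invState q ∷ []) [])) (state-index q)
  (from-yes (Fin.all? λ k → T? (bisimilar (state k ∷ invState (state k) ∷ []) [])) (index q))

portrait-⁻¹ : ∀ q → portrait q ⁻¹ ≋ portrait (invState q)
portrait-⁻¹ q = ≋-sym (inverseʳ-unique (portrait q) (portrait (invState q)) (begin
  portrait q * portrait (invState q)              ≈⟨ *-cong portrait⋆-[ q ] portrait⋆-[ invState q ] ⟨
  portrait⋆ [ q ] * portrait⋆ [ invState q ]       ≈⟨ portrait⋆-++ [ q ] [ invState q ] ⟨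
  portrait⋆ (q ∷ invState q ∷ [])                  ≈⟨ bisimilar⇒≋ _ _ (invState-inverse q) ⟩
  portrait⋆ []                                     ≈⟨ portrait⋆-[] ⟩
  e                                                ∎))
  where open ≋-Reasoning

conj-portrait⋆ : ∀ q qs → conj (portrait q) (portrait⋆ qs) ≋ portrait⋆ (q ∷ qs ++ [ invState q ])
conj-portrait⋆ q qs = begin
  portrait q * portrait⋆ qs * portrait q ⁻¹
    ≈⟨ *-cong (*-cong (≋-sym portrait⋆-[ q ]) (≋-refl {portrait⋆ qs})) (portrait-⁻¹ q) ⟩
  portrait⋆ [ q ] * portrait⋆ qs * portrait (invState q)
    ≈⟨ *-cong (portrait⋆-++ [ q ] qs) portrait⋆-[ invState q ] ⟨
  portrait⋆ (q ∷ qs) * portrait⋆ [ invState q ]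
    ≈⟨ portrait⋆-++ (q ∷ qs) [ invState q ] ⟨
  portrait⋆ (q ∷ qs ++ [ invState q ])
    ∎
  where open ≋-Reasoning

-- The conjugates of c = a₂a₃⁻¹

conjugate : Fin 4 → List St
conjugate 0F = s2 ∷ s3i ∷ []
conjugate 1F = sσ ∷ s2 ∷ s3i ∷ sσ ∷ []
conjugate 2F = s2 ∷ s2 ∷ s3i ∷ s2i ∷ []
conjugate 3F = s2i ∷ s2 ∷ s3i ∷ s2 ∷ []

Conjugates : Pred Ω 0ℓ
Conjugates g = ∃[ i ] portrait⋆ (conjugate i) ≡ g

N : Pred Ω 0ℓ
N = Gen≋ Conjugates

InvariantUnder : St → Set
InvariantUnder q = ∀ i → ∃[ j ] T (bisimilar (q ∷ conjugate i ++ [ invState q ]) (conjugate j))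

invariantUnder? : ∀ q → Dec (InvariantUnder q)
invariantUnder? q = Fin.all? λ i → Fin.any? λ j →
  T? (bisimilar (q ∷ conjugate i ++ [ invState q ]) (conjugate j))

invariantUnder-a₁ : InvariantUnder sσ
invariantUnder-a₁ = from-yes (invariantUnder? sσ)

invariantUnder-a₂ : InvariantUnder s2
invariantUnder-a₂ = from-yes (invariantUnder? s2)

invariantUnder-a₂⁻¹ : InvariantUnder s2i
invariantUnder-a₂⁻¹ = from-yes (invariantUnder? s2i)

conjugates-commute : ∀ i j → i <ᶠ j
                   → T (bisimilar (conjugate i ++ conjugate j) (conjugate j ++ conjugate i))
conjugates-commute = from-yes (Fin.all? λ i → Fin.all? λ j →
  (i Fin.<? j) →-dec T? (bisimilar (conjugate i ++ conjugate j) (conjugate j ++ conjugate i)))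

portrait⋆-commute : ∀ ps qs → T (bisimilar (ps ++ qs) (qs ++ ps))
                  → Commute (portrait⋆ ps) (portrait⋆ qs)
portrait⋆-commute ps qs ps++qs=qs++ps =
  ≋-trans (≋-sym (portrait⋆-++ ps qs)) (≋-trans (bisimilar⇒≋ _ _ ps++qs=qs++ps) (portrait⋆-++ qs ps))

Conjugates-commute : ∀ {s t} → Conjugates s → Conjugates t → Commute s t
Conjugates-commute (i , refl) (j , refl) with Fin.<-cmp i j
... | tri< i<j _ _  = portrait⋆-commute (conjugate i) (conjugate j) (conjugates-commute i j i<j)
... | tri≈ _ refl _ = ≋-refl
... | tri> _ _ j<i  = ≋-sym (portrait⋆-commute (conjugate j) (conjugate i) (conjugates-commute j i j<i))

invariantUnder⇒normalises : ∀ q → InvariantUnder q → Normalises (portrait q) N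
invariantUnder⇒normalises q q-invariant = Gen≋-normalises λ where
  (i , refl) → let j , qcq⁻¹=cⱼ = q-invariant i
               in portrait⋆ (conjugate j) , gen (j , refl) ,
                  ≋-trans (conj-portrait⋆ q (conjugate i)) (bisimilar⇒≋ _ _ qcq⁻¹=cⱼ)

portrait∈Normaliser : ∀ q → Normalises (portrait q) N → Normalises (portrait (invState q)) N
                    → Normaliser N (portrait q)
portrait∈Normaliser q q-norm q⁻¹-norm =
  q-norm , normalises-resp Gen≋-resp (≋-sym (portrait-⁻¹ q)) q⁻¹-norm

a₁∈Normaliser : Normaliser N a₁
a₁∈Normaliser = portrait∈Normaliser sσ (invariantUnder⇒normalises sσ invariantUnder-a₁)
                                       (invariantUnder⇒normalises sσ invariantUnder-a₁)

a₂∈Normaliser : Normaliser N a₂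
a₂∈Normaliser = portrait∈Normaliser s2 (invariantUnder⇒normalises s2 invariantUnder-a₂)
                                       (invariantUnder⇒normalises s2i invariantUnder-a₂⁻¹)

c∈N : N (a₂ * a₃ ⁻¹)
c∈N = Gen≋-resp (≋-sym c≋conjugate₀) (_ , gen (0F , refl) , ≋-refl)
  where
  c≋conjugate₀ : a₂ * a₃ ⁻¹ ≋ portrait⋆ (conjugate 0F)
  c≋conjugate₀ = begin
    portrait s2 * portrait s3 ⁻¹            ≈⟨ *-cong (≋-refl {a₂}) (portrait-⁻¹ s3) ⟩
    portrait s2 * portrait s3i              ≈⟨ *-cong portrait⋆-[ s2 ] portrait⋆-[ s3i ] ⟨
    portrait⋆ [ s2 ] * portrait⋆ [ s3i ]     ≈⟨ portrait⋆-++ [ s2 ] [ s3i ] ⟨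
    portrait⋆ (s2 ∷ s3i ∷ [])                ∎
    where open ≋-Reasoning

Gens⊆Normaliser : Gens ⊆ Normaliser N
Gens⊆Normaliser (inj₁ refl)        = a₁∈Normaliser
Gens⊆Normaliser (inj₂ (inj₁ refl)) = a₂∈Normaliser
Gens⊆Normaliser (inj₂ (inj₂ refl)) =
  normaliser-resp Gen≋-resp ([x∙y⁻¹]⁻¹∙x≈y a₂ a₃)
    (normaliser-* Gen≋-resp (normaliser-⁻¹ Gen≋-resp (Gen≋⊆Normaliser c∈N)) a₂∈Normaliser)

ConjG⊆ClGen : ConjG ⊆ ClGen Conjugates
ConjG⊆ClGen (g , Gg , refl) = Cl-conj (a₂ * a₃ ⁻¹) c-conjugate∈ClGen Gg
  where
  c-conjugate∈ClGen : Gen Gens ⊆ ClGen Conjugates ∘ λ h → conj h (a₂ * a₃ ⁻¹)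
  c-conjugate∈ClGen Gh =
    Gen≋⊆ClGen (proj₁ (Gen⊆Normaliser Gen≋-resp Gens⊆Normaliser Gh) .preserves c∈N)

U⊆ClGen : U ⊆ ClGen Conjugates
U⊆ClGen = ClGen-least ConjG⊆ClGen

proposition3p7 : ∀ (u v : Ω) → U u → U v → (u * v) ≈ (v * u)
proposition3p7 u v Uu Uv = Cl-abelian (Gen-abelian Conjugates-commute) (U⊆ClGen Uu) (U⊆ClGen Uv) .at
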